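{- Let $T$ be a tree of the underlying forest, and let $a$ and $b$ be valid clusters of $T$ (edge-disjoint) such that exactly one vertex $v$ of $T$ is incident both to an edge of $a$ and to an edge of $b$. Then the edge set $a \cup b$ is an invalid cluster (i.e. has more than two boundary vertices) if and only if all three of the following hold: $a$ is a path cluster, $b$ is a path cluster, and $v$ is a boundary vertex of $a \cup b$.
   Context: Let $F$ be a forest (the underlying forest) in which some vertices are marked as exposed. For a set $C$ of edges of $F$, a vertex $w$ is a boundary vertex of $C$ if $w$ is incident to an edge of $C$ and either $w$ is exposed or $w$ is incident to an edge of $F$ not in $C$. A cluster is a nonempty connected set of edges; it is valid if it has at most two boundary vertices. A valid cluster is a path cluster if it has exactly two boundary vertices and a point cluster if it has zero or one boundary vertices. -}

module Defs where

open import Data.Nat using (ℕ; suc)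
open import Data.Fin using (Fin; zero; suc; inject₁; fromℕ)
open import Data.Fin.Subset using (Subset; _∈_; _∉_; _∪_) public
open import Data.Product using (Σ; ∃; ∃-syntax; _×_; _,_)
open import Data.Sum using (_⊎_)
open import Relation.Nullary using (¬_)
open import Relation.Binary.PropositionalEquality using (_≡_; _≢_)
open import Relation.Binary.Construct.Closure.ReflexiveTransitive using (Star)
open import Function.Definitions using (Injective)

record Graph (n m : ℕ) : Set where
  field
    src     : Fin m → Fin n
    tgt     : Fin m → Fin n
    exposed : Subset n

module _ {n m : ℕ} (G : Graph n m) where
  open Graph G

  Joins : Fin m → Fin n → Fin n → Set
  Joins e x y = (src e ≡ x × tgt e ≡ y) ⊎ (src e ≡ y × tgt e ≡ x)

  record Cycle : Set where
    field
      k      : ℕ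
      es     : Fin (suc k) → Fin m
      vs     : Fin (suc (suc k)) → Fin n
      step   : ∀ i → Joins (es i) (vs (inject₁ i)) (vs (suc i))
      closed : vs zero ≡ vs (fromℕ (suc k))
      es-inj : Injective _≡_ _≡_ es
      vs-inj : Injective _≡_ _≡_ (λ i → vs (inject₁ i))

  Acyclic : Set
  Acyclic = ¬ Cycle

  Incident : Fin n → Fin m → Set
  Incident w e = src e ≡ w ⊎ tgt e ≡ w

  Touches : Subset m → Fin n → Set
  Touches C w = ∃[ e ] (e ∈ C × Incident w e)

  IsBoundary : Subset m → Fin n → Set
  IsBoundary C w =
    Touches C w × (w ∈ exposed ⊎ ∃[ e ] (e ∉ C × Incident w e))

  ShareVertex : Fin m → Fin m → Set
  ShareVertex e f = ∃[ w ] (Incident w e × Incident w f)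

  data Chain (C : Subset m) : Fin m → Fin m → Set where
    here : ∀ {e} → e ∈ C → Chain C e e
    next : ∀ {e f g} → Chain C e f → g ∈ C → ShareVertex f g → Chain C e g

  IsCluster : Subset m → Set
  IsCluster C = (∃[ e ] e ∈ C) × (∀ e f → e ∈ C → f ∈ C → Chain C e f)

  Adjacent : Fin n → Fin n → Set
  Adjacent x y = ∃[ e ] Joins e x y

  -- t is (the vertex set of) a tree of G: a connected component
  IsTree : Subset n → Set
  IsTree t = (∃[ v ] v ∈ t)
           × (∀ e → (src e ∈ t → tgt e ∈ t) × (tgt e ∈ t → src e ∈ t))
           × (∀ x y → x ∈ t → y ∈ t → Star Adjacent x y)

  EdgesOf : Subset n → Subset m → Set
  EdgesOf t C = ∀ e → e ∈ C → src e ∈ t × tgt e ∈ t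

module _ {n : ℕ} (P : Fin n → Set) where
  AtMostOne : Set
  AtMostOne = ∀ x y → P x → P y → x ≡ y

  AtMostTwo : Set
  AtMostTwo = ∀ x y z → P x → P y → P z → x ≡ y ⊎ x ≡ z ⊎ y ≡ z

  ExactlyTwo : Set
  ExactlyTwo = ∃[ x ] ∃[ y ] (x ≢ y × P x × P y × (∀ z → P z → z ≡ x ⊎ z ≡ y))

  MoreThanTwo : Set
  MoreThanTwo = ∃[ x ] ∃[ y ] ∃[ z ]
    (P x × P y × P z × x ≢ y × x ≢ z × y ≢ z)

record Forest (n m : ℕ) : Set where
  field
    graph   : Graph n m
    acyclic : Acyclic graph

module _ {n m : ℕ} (F : Forest n m) where
  open Forest F

  Valid : Subset m → Set
  Valid C = IsCluster graph C × AtMostTwo (IsBoundary graph C)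

  PathCluster : Subset m → Set
  PathCluster C = Valid C × ExactlyTwo (IsBoundary graph C)

  PointCluster : Subset m → Set
  PointCluster C = Valid C × AtMostOne (IsBoundary graph C)

  InvalidCluster : Subset m → Set
  InvalidCluster C = IsCluster graph C × MoreThanTwo (IsBoundary graph C)

{-# OPTIONS --safe #-}
module Submission where

-- Away from v the boundaries of a, b and a ∪ b coincide, and v is a boundary
-- vertex of both a and b.  Hence ∂(a ∪ b) ⊆ {v} ∪ (∂a ∖ {v}) ∪ (∂b ∖ {v}), where
-- validity makes each of the last two sets have at most one element, and both
-- are contained in ∂(a ∪ b).  So ∂(a ∪ b) has three elements exactly when v is
-- among them and a and b each have a second boundary vertex, i.e. are path
-- clusters.  Neither acyclicity nor the ambient tree plays any role.

open import Defs
open import Data.Nat using (ℕ)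
open import Data.Fin using (Fin; _≟_)
open import Data.Fin.Subset using (Subset; _∈_; _∉_; _∪_; _⊆_)
open import Data.Fin.Subset.Properties using (x∈p∪q⁻; p⊆p∪q; q⊆p∪q; ∪-comm)
open import Data.Product using (∃-syntax; _×_; _,_; proj₁; proj₂)
open import Data.Sum using (_⊎_; inj₁; inj₂)
open import Data.Empty using (⊥-elim)
open import Relation.Nullary using (¬_; yes; no)
open import Relation.Binary.PropositionalEquality using (_≡_; _≢_; refl; sym; trans; subst)
open import Function.Bundles using (_⇔_; mk⇔)

module _ {n : ℕ} {P : Fin n → Set} where

  AtMostTwo⇒AtMostOne-except : ∀ {v} → AtMostTwo P → P v → AtMostOne (λ w → w ≢ v × P w)
  AtMostTwo⇒AtMostOne-except {v} P≤2 pv x y (x≢v , px) (y≢v , py) with P≤2 x y v px py pv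
  ... | inj₁ x≡y         = x≡y
  ... | inj₂ (inj₁ x≡v) = ⊥-elim (x≢v x≡v)
  ... | inj₂ (inj₂ y≡v) = ⊥-elim (y≢v y≡v)

  AtMostTwo⇒ExactlyTwo : ∀ {p v} → AtMostTwo P → P p → P v → p ≢ v → ExactlyTwo P
  AtMostTwo⇒ExactlyTwo {p} {v} P≤2 pp pv p≢v =
    p , v , p≢v , pp , pv , λ z pz → others (P≤2 p v z pp pv pz)
    where
    others : ∀ {z} → p ≡ v ⊎ p ≡ z ⊎ v ≡ z → z ≡ p ⊎ z ≡ v
    others (inj₁ p≡v)        = ⊥-elim (p≢v p≡v)
    others (inj₂ (inj₁ p≡z)) = inj₁ (sym p≡z)
    others (inj₂ (inj₂ v≡z)) = inj₂ (sym v≡z)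

  ExactlyTwo⇒∃≢ : ExactlyTwo P → ∀ v → ∃[ p ] (p ≢ v × P p)
  ExactlyTwo⇒∃≢ (x , y , x≢y , px , py , _) v with x ≟ v
  ... | yes x≡v = y , (λ y≡v → x≢y (trans x≡v (sym y≡v))) , py
  ... | no  x≢v = x , x≢v , px

  MoreThanTwo-hits-first : ∀ {Q R S : Fin n → Set} → (∀ w → P w → Q w ⊎ R w ⊎ S w)
    → AtMostOne R → AtMostOne S → MoreThanTwo P → ∃[ w ] (P w × Q w)
  MoreThanTwo-hits-first {Q} {R} {S} cover R≤1 S≤1 (x , y , z , px , py , pz , x≢y , x≢z , y≢z) =
    hit (cover x px) (cover y py) (cover z pz)
    where
    hit : Q x ⊎ R x ⊎ S x → Q y ⊎ R y ⊎ S y → Q z ⊎ R z ⊎ S z → ∃[ w ] (P w × Q w)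
    hit (inj₁ qx) _ _ = x , px , qx
    hit _ (inj₁ qy) _ = y , py , qy
    hit _ _ (inj₁ qz) = z , pz , qz
    hit (inj₂ (inj₁ rx)) (inj₂ (inj₁ ry)) _ = ⊥-elim (x≢y (R≤1 x y rx ry))
    hit (inj₂ (inj₁ rx)) _ (inj₂ (inj₁ rz)) = ⊥-elim (x≢z (R≤1 x z rx rz))
    hit _ (inj₂ (inj₁ ry)) (inj₂ (inj₁ rz)) = ⊥-elim (y≢z (R≤1 y z ry rz))
    hit (inj₂ (inj₂ sx)) (inj₂ (inj₂ sy)) _ = ⊥-elim (x≢y (S≤1 x y sx sy))
    hit (inj₂ (inj₂ sx)) _ (inj₂ (inj₂ sz)) = ⊥-elim (x≢z (S≤1 x z sx sz))
    hit _ (inj₂ (inj₂ sy)) (inj₂ (inj₂ sz)) = ⊥-elim (y≢z (S≤1 y z sy sz))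

  MoreThanTwo-hits-all : ∀ {Q R S : Fin n → Set} → (∀ w → P w → Q w ⊎ R w ⊎ S w)
    → AtMostOne Q → AtMostOne R → AtMostOne S → MoreThanTwo P
    → (∃[ w ] (P w × Q w)) × (∃[ w ] (P w × R w)) × (∃[ w ] (P w × S w))
  MoreThanTwo-hits-all cover Q≤1 R≤1 S≤1 P>2 =
      MoreThanTwo-hits-first cover R≤1 S≤1 P>2
    , MoreThanTwo-hits-first (λ w pw → rotate (cover w pw)) S≤1 Q≤1 P>2
    , MoreThanTwo-hits-first (λ w pw → rotate (rotate (cover w pw))) Q≤1 R≤1 P>2
    where
    rotate : ∀ {A B C : Set} → A ⊎ B ⊎ C → B ⊎ C ⊎ A
    rotate (inj₁ x)        = inj₂ (inj₂ x)
    rotate (inj₂ (inj₁ x)) = inj₁ x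
    rotate (inj₂ (inj₂ x)) = inj₂ (inj₁ x)

module _ {n m : ℕ} (G : Graph n m) where

  Chain-mono : ∀ {C D e f} → C ⊆ D → Chain G C e f → Chain G D e f
  Chain-mono C⊆D (here e∈C)        = here (C⊆D e∈C)
  Chain-mono C⊆D (next c g∈C f~g) = next (Chain-mono C⊆D c) (C⊆D g∈C) f~g

  Chain-++ : ∀ {C e f g} → Chain G C e f → Chain G C f g → Chain G C e g
  Chain-++ c (here _)         = c
  Chain-++ c (next d h∈C g~h) = next (Chain-++ c d) h∈C g~h

  ShareVertex-sym : ∀ {e f} → ShareVertex G e f → ShareVertex G f e
  ShareVertex-sym (w , w∈e , w∈f) = w , w∈f , w∈e

  ∪-isCluster : ∀ {a b e f} → IsCluster G a → IsCluster G b
    → e ∈ a → f ∈ b → ShareVertex G e f → IsCluster G (a ∪ b)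
  ∪-isCluster {a} {b} {e} {f} (_ , conn-a) (_ , conn-b) e∈a f∈b e~f = (e , a⊆a∪b e∈a) , conn
    where
    a⊆a∪b : a ⊆ a ∪ b
    a⊆a∪b = p⊆p∪q b
    b⊆a∪b : b ⊆ a ∪ b
    b⊆a∪b = q⊆p∪q a b
    conn : ∀ x y → x ∈ a ∪ b → y ∈ a ∪ b → Chain G (a ∪ b) x y
    conn x y x∈ y∈ with x∈p∪q⁻ a b x∈ | x∈p∪q⁻ a b y∈
    ... | inj₁ x∈a | inj₁ y∈a = Chain-mono a⊆a∪b (conn-a x y x∈a y∈a)
    ... | inj₂ x∈b | inj₂ y∈b = Chain-mono b⊆a∪b (conn-b x y x∈b y∈b)
    ... | inj₁ x∈a | inj₂ y∈b =
      Chain-++ (next (Chain-mono a⊆a∪b (conn-a x e x∈a e∈a)) (b⊆a∪b f∈b) e~f)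
               (Chain-mono b⊆a∪b (conn-b f y f∈b y∈b))
    ... | inj₂ x∈b | inj₁ y∈a =
      Chain-++ (next (Chain-mono b⊆a∪b (conn-b x f x∈b f∈b)) (a⊆a∪b e∈a) (ShareVertex-sym e~f))
               (Chain-mono a⊆a∪b (conn-a e y e∈a y∈a))

  Touches-mono : ∀ {C D w} → C ⊆ D → Touches G C w → Touches G D w
  Touches-mono C⊆D (e , e∈C , w∈e) = e , C⊆D e∈C , w∈e

  Touches-∪⁻ : ∀ a b {w} → Touches G (a ∪ b) w → Touches G a w ⊎ Touches G b w
  Touches-∪⁻ a b (e , e∈a∪b , w∈e) with x∈p∪q⁻ a b e∈a∪b
  ... | inj₁ e∈a = inj₁ (e , e∈a , w∈e)
  ... | inj₂ e∈b = inj₂ (e , e∈b , w∈e)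

  IsBoundary-antimono : ∀ {C D w} → C ⊆ D → Touches G C w → IsBoundary G D w → IsBoundary G C w
  IsBoundary-antimono _   w~C (_ , inj₁ exp) = w~C , inj₁ exp
  IsBoundary-antimono C⊆D w~C (_ , inj₂ (e , e∉D , w∈e)) =
    w~C , inj₂ (e , (λ e∈C → e∉D (C⊆D e∈C)) , w∈e)

  IsBoundary-∪⁻ : ∀ a b {w} → IsBoundary G (a ∪ b) w → IsBoundary G a w ⊎ IsBoundary G b w
  IsBoundary-∪⁻ a b ∂w@(w~a∪b , _) with Touches-∪⁻ a b w~a∪b
  ... | inj₁ w~a = inj₁ (IsBoundary-antimono (p⊆p∪q b) w~a ∂w)
  ... | inj₂ w~b = inj₂ (IsBoundary-antimono (q⊆p∪q a b) w~b ∂w)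

  IsBoundary-∪⁺ˡ : ∀ {a} b {w} → IsBoundary G a w → ¬ Touches G b w → IsBoundary G (a ∪ b) w
  IsBoundary-∪⁺ˡ b (w~a , inj₁ exp) _ = Touches-mono (p⊆p∪q b) w~a , inj₁ exp
  IsBoundary-∪⁺ˡ {a} b (w~a , inj₂ (e , e∉a , w∈e)) w≁b =
    Touches-mono (p⊆p∪q b) w~a , inj₂ (e , e∉a∪b , w∈e)
    where
    e∉a∪b : e ∉ a ∪ b
    e∉a∪b e∈a∪b with x∈p∪q⁻ a b e∈a∪b
    ... | inj₁ e∈a = e∉a e∈a
    ... | inj₂ e∈b = w≁b (e , e∈b , w∈e)

  IsBoundary-∪⁺ʳ : ∀ a {b w} → IsBoundary G b w → ¬ Touches G a w → IsBoundary G (a ∪ b) w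
  IsBoundary-∪⁺ʳ a {b} ∂b w≁a =
    subst (λ C → IsBoundary G C _) (∪-comm b a) (IsBoundary-∪⁺ˡ a ∂b w≁a)

  IsBoundary-shared : ∀ {a b v} → (∀ e → e ∈ b → e ∉ a)
    → Touches G a v → Touches G b v → IsBoundary G a v
  IsBoundary-shared b∩a=∅ v~a (f , f∈b , v∈f) = v~a , inj₂ (f , b∩a=∅ f f∈b , v∈f)

module SharedVertex {n m : ℕ} (F : Forest n m) {a b : Subset m} {v : Fin n}
  (a-valid : Valid F a) (b-valid : Valid F b)
  (disjoint : ∀ e → e ∈ a → e ∉ b)
  (v~a : Touches (Forest.graph F) a v) (v~b : Touches (Forest.graph F) b v)
  (only-v : ∀ w → Touches (Forest.graph F) a w → Touches (Forest.graph F) b w → w ≡ v)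
  where

  open Forest F using (graph)

  ∂ : Subset m → Fin n → Set
  ∂ = IsBoundary graph

  v∈∂a : ∂ a v
  v∈∂a = IsBoundary-shared graph (λ e e∈b e∈a → disjoint e e∈a e∈b) v~a v~b

  v∈∂b : ∂ b v
  v∈∂b = IsBoundary-shared graph disjoint v~b v~a

  ∂a∖v≤1 : AtMostOne (λ w → w ≢ v × ∂ a w)
  ∂a∖v≤1 = AtMostTwo⇒AtMostOne-except (proj₂ a-valid) v∈∂a

  ∂b∖v≤1 : AtMostOne (λ w → w ≢ v × ∂ b w)
  ∂b∖v≤1 = AtMostTwo⇒AtMostOne-except (proj₂ b-valid) v∈∂b

  ≡v≤1 : AtMostOne (λ w → w ≡ v)
  ≡v≤1 _ _ x≡v y≡v = trans x≡v (sym y≡v)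

  ∂∪-classify : ∀ w → ∂ (a ∪ b) w → w ≡ v ⊎ (w ≢ v × ∂ a w) ⊎ (w ≢ v × ∂ b w)
  ∂∪-classify w ∂w with w ≟ v | IsBoundary-∪⁻ graph a b ∂w
  ... | yes w≡v | _       = inj₁ w≡v
  ... | no  w≢v | inj₁ ∂a = inj₂ (inj₁ (w≢v , ∂a))
  ... | no  w≢v | inj₂ ∂b = inj₂ (inj₂ (w≢v , ∂b))

  ∪-cluster : IsCluster graph (a ∪ b)
  ∪-cluster =
    let (e , e∈a , v∈e) = v~a
        (f , f∈b , v∈f) = v~b
    in ∪-isCluster graph (proj₁ a-valid) (proj₁ b-valid) e∈a f∈b (v , v∈e , v∈f)

  invalid⇒paths : InvalidCluster F (a ∪ b) → PathCluster F a × PathCluster F b × ∂ (a ∪ b) v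
  invalid⇒paths (_ , ∂>2) with MoreThanTwo-hits-all ∂∪-classify ≡v≤1 ∂a∖v≤1 ∂b∖v≤1 ∂>2
  ... | (_ , v∈∂ , refl) , (p , _ , p≢v , p∈∂a) , (q , _ , q≢v , q∈∂b) =
      (a-valid , AtMostTwo⇒ExactlyTwo (proj₂ a-valid) p∈∂a v∈∂a p≢v)
    , (b-valid , AtMostTwo⇒ExactlyTwo (proj₂ b-valid) q∈∂b v∈∂b q≢v)
    , v∈∂

  paths⇒invalid : PathCluster F a × PathCluster F b × ∂ (a ∪ b) v → InvalidCluster F (a ∪ b)
  paths⇒invalid ((_ , ∂a=2) , (_ , ∂b=2) , v∈∂)
    with ExactlyTwo⇒∃≢ ∂a=2 v | ExactlyTwo⇒∃≢ ∂b=2 v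
  ... | p , p≢v , p∈∂a@(p~a , _) | q , q≢v , q∈∂b@(q~b , _) =
      ∪-cluster
    , p , q , v
    , IsBoundary-∪⁺ˡ graph b p∈∂a (λ p~b → p≢v (only-v p p~a p~b))
    , IsBoundary-∪⁺ʳ graph a q∈∂b (λ q~a → q≢v (only-v q q~a q~b))
    , v∈∂
    , (λ { refl → p≢v (only-v p p~a q~b) })
    , p≢v , q≢v

lemma4p1 : ∀ {n m} (F : Forest n m) (T : Subset n) (a b : Subset m) (v : Fin n)
    → IsTree (Forest.graph F) T
    → EdgesOf (Forest.graph F) T a → EdgesOf (Forest.graph F) T b
    → Valid F a → Valid F b
    → (∀ e → e ∈ a → e ∉ b)
    → Touches (Forest.graph F) a v → Touches (Forest.graph F) b v
    → (∀ w → Touches (Forest.graph F) a w → Touches (Forest.graph F) b w → w ≡ v)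
    → InvalidCluster F (a ∪ b)
      ⇔ (PathCluster F a × PathCluster F b × IsBoundary (Forest.graph F) (a ∪ b) v)
lemma4p1 F _ _ _ _ _ _ _ a-valid b-valid disjoint v~a v~b only-v =
  mk⇔ invalid⇒paths paths⇒invalid
  where open SharedVertex F a-valid b-valid disjoint v~a v~b only-v
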